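{- Let $\lambda=(\lambda_1,\dots,\lambda_m)$ be a partition of $n$ whose parts are distinct with the possible exception of the largest part, i.e. every part of $\lambda$ smaller than $\lambda_1$ occurs exactly once. Then $b_\lambda(-1)$ equals the number of standard shifted tableaux of shape $\lambda$.
   Context: For a standard tableau $T=(T_{ij})$ of shape $\lambda$ (a filling of the Young diagram of $\lambda$ with $1,\dots,|\lambda|$, rows and columns increasing), and $2\le j\le\lambda_i$, let $c_{ij}(T)=\#\{i'\ge i:\text{cell }(i',j-1)\text{ exists and }T_{i',j-1}<T_{ij}\}$, $c_q(T)=\prod_i\prod_{j=2}^{\lambda_i}[c_{ij}(T)]_q$ with $[a]_q=1+q+\dots+q^{a-1}$, and $b_\lambda(q)=\sum_T c_q(T)$ over all standard tableaux $T$ of shape $\lambda$. A shifted tableau of shape $\lambda$ is an array $(T_{ij})$ with $1\le i\le m$ and $i\le j\le\lambda_i+i-1$ (row $i$ shifted $i-1$ cells to the right). It is a standard shifted tableau if its entries are exactly $1,\dots,n$, each once, and rows increase left to right, columns increase top to bottom, and diagonals increase from top-left to bottom-right. -}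

module Defs where

open import Data.Nat using (ℕ; zero; suc; _<_; _≥_; _<ᵇ_; _∸_)
open import Data.Nat.Properties using (_≟_)
open import Data.Integer as ℤ using (ℤ; +_; -[1+_])
open import Data.Bool using (Bool; true; false; if_then_else_)
open import Data.Maybe using (Maybe; just; nothing)
open import Data.List using (List; []; _∷_; length; concat; map; filter; upTo; drop)
open import Data.Nat.ListAction using (sum)
open import Data.List.Relation.Unary.All using (All)
open import Data.List.Relation.Unary.Linked using (Linked)
open import Data.List.Relation.Unary.Unique.Propositional using (Unique)
open import Data.List.Membership.Propositional using (_∈_)
open import Data.List.Relation.Binary.Permutation.Propositional using (_↭_)
open import Data.Product using (_×_)
open import Data.Unit using (⊤)
open import Function.Bundles using (_⇔_)
open import Relation.Binary.PropositionalEquality using (_≡_)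

IsPartition : List ℕ → Set
IsPartition ps = All (0 <_) ps × Linked _≥_ ps

AlmostStrict : List ℕ → Set
AlmostStrict [] = ⊤
AlmostStrict (h ∷ t) = ∀ k → k ∈ (h ∷ t) → k < h → length (filter (k ≟_) (h ∷ t)) ≡ 1

-- Arrays: a tableau is stored as a list of rows (0-based indices).

at : {A : Set} → List A → ℕ → Maybe A
at [] _ = nothing
at (x ∷ xs) zero = just x
at (x ∷ xs) (suc k) = at xs k

rowAt : List (List ℕ) → ℕ → List ℕ
rowAt T i with at T i
... | just r = r
... | nothing = []

entry : List (List ℕ) → ℕ → ℕ → Maybe ℕ
entry T i j = at (rowAt T i) j

-- entry in cell (i,j) of a shifted array: row i (0-based) starts at column i
sentry : List (List ℕ) → ℕ → ℕ → Maybe ℕ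
sentry T i j = if j <ᵇ i then nothing else at (rowAt T i) (j ∸ i)

EntriesOneTo : ℕ → List (List ℕ) → Set
EntriesOneTo n T = concat T ↭ map suc (upTo n)

record StandardTableau (ps : List ℕ) (T : List (List ℕ)) : Set where
  field
    shape   : map length T ≡ ps
    entries : EntriesOneTo (sum ps) T
    rows    : ∀ i j x y → entry T i j ≡ just x → entry T i (suc j) ≡ just y → x < y
    cols    : ∀ i j x y → entry T i j ≡ just x → entry T (suc i) j ≡ just y → x < y

record StandardShiftedTableau (ps : List ℕ) (T : List (List ℕ)) : Set where
  field
    shape   : map length T ≡ ps
    entries : EntriesOneTo (sum ps) T
    rows    : ∀ i j x y → sentry T i j ≡ just x → sentry T i (suc j) ≡ just y → x < y
    cols    : ∀ i j x y → sentry T i j ≡ just x → sentry T (suc i) j ≡ just y → x < y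
    diags   : ∀ i j x y → sentry T i j ≡ just x → sentry T (suc i) (suc j) ≡ just y → x < y

IsEnumerationOf : {A : Set} → (A → Set) → List A → Set
IsEnumerationOf P L = Unique L × (∀ T → (T ∈ L) ⇔ P T)

qint : ℤ → ℕ → ℤ
qint q zero = + 0
qint q (suc a) = (+ 1) ℤ.+ q ℤ.* qint q a

countBelow : ℕ → ℕ → List (List ℕ) → ℕ
countBelow k x [] = 0
countBelow k x (r ∷ rs) with at r k
... | just v = (if v <ᵇ x then 1 else 0) Data.Nat.+ countBelow k x rs
... | nothing = countBelow k x rs

-- c_{ij}(T) for (0-based) row i, column j+1, entry x = T_{i,j+1}:
-- #{ i' ≥ i : cell (i', j) exists and T_{i',j} < x }
cij : List (List ℕ) → ℕ → ℕ → ℕ → ℕ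
cij T i j x = countBelow j x (drop i T)

rowProd : ℤ → List (List ℕ) → ℕ → ℕ → List ℕ → ℤ
rowProd q T i j [] = + 1
rowProd q T i j (x ∷ xs) = qint q (cij T i j x) ℤ.* rowProd q T i (suc j) xs

-- c_q(T) = ∏_i ∏_{j ≥ 2} [c_{ij}(T)]_q
cq' : ℤ → List (List ℕ) → ℕ → List (List ℕ) → ℤ
cq' q T i [] = + 1
cq' q T i ([] ∷ rs) = cq' q T (suc i) rs
cq' q T i ((_ ∷ xs) ∷ rs) = rowProd q T i 0 xs ℤ.* cq' q T (suc i) rs

cq : ℤ → List (List ℕ) → ℤ
cq q T = cq' q T 0 T

-- b_λ(q) = Σ_T c_q(T), the sum taken over an enumeration L of the standard tableaux
bOver : ℤ → List (List (List ℕ)) → ℤ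
bOver q [] = + 0
bOver q (T ∷ L) = cq q T ℤ.+ bOver q L

-- sanity check: λ = (2,1): standard tableaux [[1,2],[3]] (c=1) and [[1,3],[2]] (c=2)
private
  open import Data.Integer using (-[1+_])
  test : bOver -[1+ 0 ] (((1 ∷ 2 ∷ []) ∷ (3 ∷ []) ∷ []) ∷ ((1 ∷ 3 ∷ []) ∷ (2 ∷ []) ∷ []) ∷ []) ≡ + 1
  test = Relation.Binary.PropositionalEquality.refl

-- At q = -1 the q-integer [a]_q is 1 for odd a and 0 for even a, so c_{-1}(T) ∈ {0, 1} and
-- b_λ(-1) counts the standard tableaux T all of whose statistics c_ij(T) are odd.  Stored row by
-- row, a standard shifted tableau is exactly a standard tableau with T_{i,j+1} < T_{i+1,j}: the
-- shifted diagonals become the ordinary columns and the shifted columns become this condition.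
-- Such a tableau has every c_ij(T) = 1, since T_{i,j-1} < T_{i,j} < T_{i+1,j-1} < T_{i+2,j-1} < ⋯.
-- Conversely, if T_{i+1,j} < T_{i,j+1} = x, then T_{i,j} and T_{i+1,j} are both smaller than x, so
-- c_{i,j+1}(T) = 2 unless T_{i+2,j} < x as well.  In that case the cell (i+1, j+1) exists, as
-- otherwise rows i+1 and i+2 would be two equal parts strictly smaller than part i, hence than λ₁,
-- and T_{i+2,j} < T_{i+1,j+1} repeats the pattern one row lower, which cannot go on forever.
module Submission where

open import Defs
open import Data.Nat using (ℕ; zero; suc; _+_; _∸_; _≤_; _<_; _≥_; _<ᵇ_; z≤n; s≤s; _≤?_)
open import Data.Nat.Properties
  using (≤-refl; ≤-trans; ≤-reflexive; ≤-antisym; <-trans; <-≤-trans; <⇒≤; <⇒≱; ≤⇒≯; ≮⇒≥; ≰⇒>;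
         ≤∧≢⇒<; n≤1+n; n<1+n; m≤n+m; m+n∸n≡m; m∸n+n≡m; +-suc; +-identityʳ; suc-injective;
         <ᵇ⇒<; <⇒<ᵇ; _≟_)
open import Data.Integer as ℤ using (ℤ; +_; -[1+_]; -1ℤ)
import Data.Integer.Properties as ℤ
open import Data.Bool using (true; false)
open import Data.Bool.Properties using (T-≡)
open import Data.Maybe using (Maybe; just; nothing)
open import Data.Maybe.Properties using (just-injective)
open import Data.List using (List; []; _∷_; _++_; length; concat; map; filter)
open import Data.List.Properties using (filter-accept)
open import Data.List.Relation.Unary.All as All using (All)
open import Data.List.Relation.Unary.Any using (here; there)
open import Data.List.Relation.Unary.AllPairs using (_∷_)
open import Data.List.Relation.Unary.Linked as Linked using (Linked; _∷_)
open import Data.List.Relation.Unary.Linked.Properties using (Linked⇒All; map⁻)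
open import Data.List.Relation.Unary.Unique.Propositional using (Unique)
open import Data.List.Relation.Unary.Unique.Propositional.Properties as Unique using (upTo⁺)
open import Data.List.Membership.Propositional using (_∈_)
open import Data.List.Membership.Propositional.Properties
  using (∈-++⁺ˡ; ∈-++⁺ʳ; ∈-filter⁺; ∈-filter⁻)
open import Data.List.Membership.Propositional.Properties.WithK using (unique∧set⇒bag)
open import Data.List.Relation.Binary.BagAndSetEquality using (∼bag⇒↭)
open import Data.List.Relation.Binary.Permutation.Propositional using (↭-sym; ↭⇒↭ₛ)
open import Data.List.Relation.Binary.Permutation.Propositional.Properties using (↭-length)
import Data.List.Relation.Binary.Permutation.Setoid.Properties as ↭ₛ
open import Data.Product using (∃-syntax; _×_; _,_; proj₂)
open import Data.Sum using (_⊎_; inj₁; inj₂)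
open import Data.Empty using (⊥; ⊥-elim)
open import Function using (_on_; flip)
open import Function.Bundles using (_⇔_; mk⇔; Equivalence)
open import Relation.Nullary using (¬_; yes; no; does; contradiction)
open import Relation.Unary using (Decidable)
open import Relation.Binary.PropositionalEquality
  using (_≡_; _≢_; refl; sym; trans; cong; subst; setoid; module ≡-Reasoning)

Array : Set
Array = List (List ℕ)

module _ {A : Set} where

  at-< : ∀ (xs : List A) j {x} → at xs j ≡ just x → j < length xs
  at-< (_ ∷ xs) zero    _ = s≤s z≤n
  at-< (_ ∷ xs) (suc j) e = s≤s (at-< xs j e)

  <-at : ∀ (xs : List A) j → j < length xs → ∃[ x ] at xs j ≡ just x
  <-at (x ∷ xs) zero    _         = x , refl
  <-at (_ ∷ xs) (suc j) (s≤s j<n) = <-at xs j j<n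

  at-nothing : ∀ (xs : List A) j → at xs j ≡ nothing → length xs ≤ j
  at-nothing []       j       _ = z≤n
  at-nothing (_ ∷ xs) (suc j) e = s≤s (at-nothing xs j e)

  at-pred : ∀ (xs : List A) j {x} → at xs (suc j) ≡ just x → ∃[ y ] at xs j ≡ just y
  at-pred xs j e = <-at xs j (<-trans (n<1+n j) (at-< xs (suc j) e))

  at-∈ : ∀ (xs : List A) j {x} → at xs j ≡ just x → x ∈ xs
  at-∈ (_ ∷ xs) zero    refl = here refl
  at-∈ (_ ∷ xs) (suc j) e    = there (at-∈ xs j e)

<⇒<ᵇ≡true : ∀ {m n} → m < n → (m <ᵇ n) ≡ true
<⇒<ᵇ≡true m<n = Equivalence.to T-≡ (<⇒<ᵇ m<n)

≥⇒<ᵇ≡false : ∀ {m n} → n ≤ m → (m <ᵇ n) ≡ false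
≥⇒<ᵇ≡false {m} {n} n≤m with m <ᵇ n in e
... | false = refl
... | true  = contradiction (<ᵇ⇒< m n (Equivalence.from T-≡ e)) (≤⇒≯ n≤m)

<ᵇ≡false⇒≥ : ∀ {m n} → (m <ᵇ n) ≡ false → n ≤ m
<ᵇ≡false⇒≥ e = ≮⇒≥ λ m<n → contradiction (trans (sym (<⇒<ᵇ≡true m<n)) e) λ ()

-- Implied by AlmostStrict for partitions; unlike AlmostStrict it passes to suffixes, as the
-- row-by-row induction requires.
RepeatsAreLeading : List ℕ → Set
RepeatsAreLeading ps =
  ∀ i {u v} → at ps i ≡ just u → at ps (suc i) ≡ just v → at ps (suc (suc i)) ≡ just v → u ≤ v

part≤head : ∀ {h t} → Linked _≥_ (h ∷ t) → ∀ i {u} → at (h ∷ t) i ≡ just u → u ≤ h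
part≤head d i eu = All.lookup (Linked⇒All (flip ≤-trans) ≤-refl d) (at-∈ _ i eu)

module _ {A : Set} {P : A → Set} (P? : Decidable P) where

  filter-∷-mono : ∀ z xs → length (filter P? xs) ≤ length (filter P? (z ∷ xs))
  filter-∷-mono z xs with does (P? z)
  ... | true  = n≤1+n _
  ... | false = ≤-refl

  adjacent⇒filter≥2 : ∀ (xs : List A) i {x} → P x → at xs i ≡ just x → at xs (suc i) ≡ just x →
    2 ≤ length (filter P? xs)
  adjacent⇒filter≥2 (x ∷ _ ∷ xs) zero px refl refl =
    subst (2 ≤_) (cong length (sym (trans (filter-accept P? px) (cong (x ∷_) (filter-accept P? px)))))
      (s≤s (s≤s z≤n))
  adjacent⇒filter≥2 (z ∷ xs) (suc i) px e e' =
    ≤-trans (adjacent⇒filter≥2 xs i px e e') (filter-∷-mono z xs)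

almostStrict⇒repeatsAreLeading : ∀ {ps} → Linked _≥_ ps → AlmostStrict ps → RepeatsAreLeading ps
almostStrict⇒repeatsAreLeading {h ∷ t} d almostStrict i {u} {v} eu ev ev' = ≮⇒≥ λ v<u →
  <⇒≱ (n<1+n 1)
    (≤-trans (adjacent⇒filter≥2 (v ≟_) (h ∷ t) (suc i) refl ev ev')
             (≤-reflexive (almostStrict v (at-∈ (h ∷ t) (suc i) ev) (<-≤-trans v<u (part≤head d i eu)))))

RowStrict ColumnStrict ShiftedColumnStrict : Array → Set
RowStrict T           = ∀ i j x y → entry T i j ≡ just x → entry T i (suc j) ≡ just y → x < y
ColumnStrict T        = ∀ i j x y → entry T i j ≡ just x → entry T (suc i) j ≡ just y → x < y
ShiftedColumnStrict T = ∀ i j x y → entry T i (suc j) ≡ just x → entry T (suc i) j ≡ just y → x < y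

sentry-+ : ∀ T i j → sentry T i (j + i) ≡ entry T i j
sentry-+ T i j rewrite ≥⇒<ᵇ≡false (m≤n+m i j) | m+n∸n≡m j i = refl

sentry-suc-+ : ∀ T i j → sentry T (suc i) (suc (j + i)) ≡ entry T (suc i) j
sentry-suc-+ T i j = trans (cong (sentry T (suc i)) (sym (+-suc j i))) (sentry-+ T (suc i) j)

sentry-below-diagonal : ∀ T i → sentry T (suc i) i ≡ nothing
sentry-below-diagonal T i rewrite <⇒<ᵇ≡true (n<1+n i) = refl

sentry-just : ∀ T i j {x} → sentry T i j ≡ just x → ∃[ j' ] j ≡ j' + i × entry T i j' ≡ just x
sentry-just T i j e with j <ᵇ i in j≮i
... | false = j ∸ i , sym (m∸n+n≡m (<ᵇ≡false⇒≥ {j} {i} j≮i)) , e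

module _ {ps : List ℕ} {T : Array} where

  shifted⇒standard : StandardShiftedTableau ps T → StandardTableau ps T × ShiftedColumnStrict T
  shifted⇒standard st =
    record { shape = shape ; entries = entries ; rows = rows′ ; cols = cols′ } , shiftedCols
    where
    open StandardShiftedTableau st
    rows′ : RowStrict T
    rows′ i j x y ex ey = rows i (j + i) x y (trans (sentry-+ T i j) ex) (trans (sentry-+ T i (suc j)) ey)
    cols′ : ColumnStrict T
    cols′ i j x y ex ey = diags i (j + i) x y (trans (sentry-+ T i j) ex) (trans (sentry-suc-+ T i j) ey)
    shiftedCols : ShiftedColumnStrict T
    shiftedCols i j x y ex ey =
      cols i (suc j + i) x y (trans (sentry-+ T i (suc j)) ex) (trans (sentry-suc-+ T i j) ey)

  standard⇒shifted : StandardTableau ps T × ShiftedColumnStrict T → StandardShiftedTableau ps T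
  standard⇒shifted (st , shiftedCols) = record
    { shape = shape ; entries = entries ; rows = rows′ ; cols = cols′ ; diags = diags′ }
    where
    open StandardTableau st
    rows′ : ∀ i j x y → sentry T i j ≡ just x → sentry T i (suc j) ≡ just y → x < y
    rows′ i j x y ex ey with sentry-just T i j ex
    ... | j′ , refl , ex′ = rows i j′ x y ex′ (trans (sym (sentry-+ T i (suc j′))) ey)
    cols′ : ∀ i j x y → sentry T i j ≡ just x → sentry T (suc i) j ≡ just y → x < y
    cols′ i j x y ex ey with sentry-just T i j ex
    ... | zero   , refl , _   = contradiction (trans (sym (sentry-below-diagonal T i)) ey) λ ()
    ... | suc j′ , refl , ex′ = shiftedCols i j′ x y ex′ (trans (sym (sentry-suc-+ T i j′)) ey)
    diags′ : ∀ i j x y → sentry T i j ≡ just x → sentry T (suc i) (suc j) ≡ just y → x < y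
    diags′ i j x y ex ey with sentry-just T i j ex
    ... | j′ , refl , ex′ = cols i j′ x y ex′ (trans (sym (sentry-suc-+ T i j′)) ey)

record IsStrictTableau (T : Array) : Set where
  field
    decreasing : Linked (_≥_ on length) T
    rows       : RowStrict T
    cols       : ColumnStrict T

open IsStrictTableau

strictTableau-tail : ∀ {r T} → IsStrictTableau (r ∷ T) → IsStrictTableau T
strictTableau-tail t = record
  { decreasing = Linked.tail (decreasing t)
  ; rows       = λ i → rows t (suc i)
  ; cols       = λ i → cols t (suc i)
  }

entry-top : ∀ {T} → Linked (_≥_ on length) T → ∀ k j {w} → entry T k j ≡ just w →
  ∃[ v ] entry T 0 j ≡ just v
entry-top {r ∷ T}      _           zero    j e = _ , e
entry-top {r ∷ r' ∷ T} (r≥r' ∷ d) (suc k) j e =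
  <-at r j (<-≤-trans (at-< r' j (proj₂ (entry-top d k j e))) r≥r')

column-head-≤ : ∀ {T} → IsStrictTableau T → ∀ k j {v w} →
  entry T 0 j ≡ just v → entry T k j ≡ just w → v ≤ w
column-head-≤ t zero j ev ew = ≤-reflexive (just-injective (trans (sym ev) ew))
column-head-≤ {r ∷ T} t (suc k) j ev ew =
  let u , eu = entry-top (Linked.tail (decreasing t)) k j ew
  in <⇒≤ (<-≤-trans (cols t 0 j _ u ev eu) (column-head-≤ (strictTableau-tail t) k j eu ew))

countBelow-∷-< : ∀ {k x a} r rs → at r k ≡ just a → a < x →
  countBelow k x (r ∷ rs) ≡ suc (countBelow k x rs)
countBelow-∷-< r rs e a<x rewrite e | <⇒<ᵇ≡true a<x = refl

countBelow-≡0 : ∀ {k x} T → (∀ i w → entry T i k ≡ just w → x ≤ w) → countBelow k x T ≡ 0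
countBelow-≡0         []      _ = refl
countBelow-≡0 {k} {x} (r ∷ T) h with at r k in e
... | nothing = countBelow-≡0 T (λ i → h (suc i))
... | just w rewrite ≥⇒<ᵇ≡false (h 0 w e) = countBelow-≡0 T (λ i → h (suc i))

countBelow-column≥ : ∀ {T} → IsStrictTableau T → ∀ k {x} → (∀ {z} → entry T 0 k ≡ just z → x ≤ z) →
  countBelow k x T ≡ 0
countBelow-column≥ {T} t k x≤head = countBelow-≡0 T λ i w ew →
  let v , ev = entry-top (decreasing t) i k ew in ≤-trans (x≤head ev) (column-head-≤ t i k ev ew)

countBelow-leftNeighbour : ∀ {r T p x} → IsStrictTableau (r ∷ T) → at r (suc p) ≡ just x →
  countBelow p x (r ∷ T) ≡ suc (countBelow p x T)
countBelow-leftNeighbour {r} {T} {p} {x} t ex =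
  let a , ea = at-pred r p ex in countBelow-∷-< r T ea (rows t 0 p a x ea ex)

-- The cell (i, p+1) holding x contributes the factor [cij T i p x]_q to c_q(T).
FactorsSatisfy : (ℕ → Set) → Array → Set
FactorsSatisfy P T = ∀ i p {x} → entry T i (suc p) ≡ just x → P (cij T i p x)

shiftedColumnStrict⇒cij≡1 : ∀ {T} → IsStrictTableau T → ShiftedColumnStrict T → FactorsSatisfy (_≡ 1) T
shiftedColumnStrict⇒cij≡1 {r ∷ T} t sh (suc i) p ex =
  shiftedColumnStrict⇒cij≡1 (strictTableau-tail t) (λ i → sh (suc i)) i p ex
shiftedColumnStrict⇒cij≡1 {r ∷ T} t sh zero p {x} ex = begin
  countBelow p x (r ∷ T) ≡⟨ countBelow-leftNeighbour t ex ⟩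
  suc (countBelow p x T) ≡⟨ cong suc (countBelow-column≥ (strictTableau-tail t) p x≤head) ⟩
  1                      ∎
  where
  open ≡-Reasoning
  x≤head : ∀ {y} → entry T 0 p ≡ just y → x ≤ y
  x≤head ey = <⇒≤ (sh 0 p x _ ex ey)

plateau-below-descent : ∀ {r r' T p x y z} → Linked (_≥_ on length) (r ∷ r' ∷ T) →
  RepeatsAreLeading (map length (r ∷ r' ∷ T)) →
  at r (suc p) ≡ just x → at r' p ≡ just y → at r' (suc p) ≡ nothing → entry T 0 p ≡ just z → ⊥
plateau-below-descent {r} {r'} {r'' ∷ T} {p} (_ ∷ r'≥r'' ∷ _) leading ex ey ew ez =
  <⇒≱ (at-< r (suc p) ex) (leading 0 refl (cong just |r'|≡1+p) (cong just |r''|≡1+p))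
  where
  |r'|≡1+p : length r' ≡ suc p
  |r'|≡1+p = ≤-antisym (at-nothing r' (suc p) ew) (at-< r' p ey)
  |r''|≡1+p : length r'' ≡ suc p
  |r''|≡1+p = ≤-antisym (≤-trans r'≥r'' (≤-reflexive |r'|≡1+p)) (at-< r'' p ez)

all≥⊎just< : ∀ (m : Maybe ℕ) x → (∀ {z} → m ≡ just z → x ≤ z) ⊎ (∃[ z ] m ≡ just z × z < x)
all≥⊎just< nothing  x = inj₁ λ ()
all≥⊎just< (just z) x with x ≤? z
... | yes x≤z = inj₁ λ { refl → x≤z }
... | no  x≰z = inj₂ (z , refl , ≰⇒> x≰z)

shifted-descent-propagates : ∀ {r r' T p x y} → IsStrictTableau (r ∷ r' ∷ T) →
  RepeatsAreLeading (map length (r ∷ r' ∷ T)) → FactorsSatisfy (_≢ 2) (r ∷ r' ∷ T) →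
  at r (suc p) ≡ just x → at r' p ≡ just y → y < x →
  ∃[ w ] ∃[ z ] at r' (suc p) ≡ just w × entry T 0 p ≡ just z × z < w
shifted-descent-propagates {r} {r'} {T} {p} {x} t leading c≢2 ex ey y<x with all≥⊎just< (entry T 0 p) x
... | inj₁ x≤head = contradiction cij≡2 (c≢2 0 p ex)
  where
  open ≡-Reasoning
  cij≡2 : countBelow p x (r ∷ r' ∷ T) ≡ 2
  cij≡2 = begin
    countBelow p x (r ∷ r' ∷ T)   ≡⟨ countBelow-leftNeighbour t ex ⟩
    suc (countBelow p x (r' ∷ T)) ≡⟨ cong suc (countBelow-∷-< r' T ey y<x) ⟩
    2 + countBelow p x T          ≡⟨ cong (λ c → 2 + c) (countBelow-column≥ t″ p x≤head) ⟩
    2                             ∎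
    where t″ = strictTableau-tail (strictTableau-tail t)
... | inj₂ (z , ez , z<x) with at r' (suc p) in ew
...   | just w  = w , z , refl , ez , <-trans z<x (cols t 0 (suc p) x w ex ew)
...   | nothing = ⊥-elim (plateau-below-descent (decreasing t) leading ex ey ew ez)

no-shifted-descent : ∀ {T} → IsStrictTableau T → RepeatsAreLeading (map length T) →
  FactorsSatisfy (_≢ 2) T → ∀ i p {x y} → entry T i (suc p) ≡ just x → entry T (suc i) p ≡ just y → ¬ y < x
no-shifted-descent {r ∷ T} t leading c≢2 (suc i) p ex ey =
  no-shifted-descent (strictTableau-tail t) (λ i → leading (suc i)) (λ i → c≢2 (suc i)) i p ex ey
no-shifted-descent {r ∷ r' ∷ T} t leading c≢2 zero p ex ey y<x =
  let _ , _ , ew , ez , z<w = shifted-descent-propagates t leading c≢2 ex ey y<x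
  in no-shifted-descent (strictTableau-tail t) (λ i → leading (suc i)) (λ i → c≢2 (suc i)) 0 p ew ez z<w

unique-++-disjoint : ∀ {A : Set} (xs : List A) {ys x} → Unique (xs ++ ys) → x ∈ xs → x ∈ ys → ⊥
unique-++-disjoint (_ ∷ xs) (x∉ ∷ _) (here refl)  x∈ys = All.lookup x∉ (∈-++⁺ʳ xs x∈ys) refl
unique-++-disjoint (_ ∷ xs) (_ ∷ u)  (there x∈xs) x∈ys = unique-++-disjoint xs u x∈xs x∈ys

unique-++ʳ : ∀ {A : Set} (xs : List A) {ys} → Unique (xs ++ ys) → Unique ys
unique-++ʳ []       u       = u
unique-++ʳ (_ ∷ xs) (_ ∷ u) = unique-++ʳ xs u

adjacent-rows-disjoint : ∀ T → Unique (concat T) → ∀ i j j' {x} →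
  entry T i j ≡ just x → entry T (suc i) j' ≡ just x → ⊥
adjacent-rows-disjoint (r ∷ r' ∷ T) u zero j j' e e' =
  unique-++-disjoint r u (at-∈ r j e) (∈-++⁺ˡ (at-∈ r' j' e'))
adjacent-rows-disjoint (r ∷ T) u (suc i) j j' e e' =
  adjacent-rows-disjoint T (unique-++ʳ r u) i j j' e e'

factors≢2⇒shiftedColumnStrict : ∀ {T} → IsStrictTableau T → Unique (concat T) →
  RepeatsAreLeading (map length T) → FactorsSatisfy (_≢ 2) T → ShiftedColumnStrict T
factors≢2⇒shiftedColumnStrict {T} t u leading c≢2 i p x y ex ey =
  ≤∧≢⇒< (≮⇒≥ (no-shifted-descent t leading c≢2 i p ex ey))
        (λ { refl → adjacent-rows-disjoint T u i (suc p) p ex ey })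

IsBit : ℤ → Set
IsBit z = z ≡ + 0 ⊎ z ≡ + 1

*-isBit : ∀ {a b} → IsBit a → IsBit b → IsBit (a ℤ.* b)
*-isBit (inj₁ refl) _           = inj₁ refl
*-isBit (inj₂ refl) (inj₁ refl) = inj₁ refl
*-isBit (inj₂ refl) (inj₂ refl) = inj₂ refl

*-≡1⁻ : ∀ {a b} → IsBit a → IsBit b → a ℤ.* b ≡ + 1 → a ≡ + 1 × b ≡ + 1
*-≡1⁻ (inj₂ refl) (inj₂ refl) _  = refl , refl
*-≡1⁻ (inj₁ refl) _           ()
*-≡1⁻ (inj₂ refl) (inj₁ refl) ()

qint-isBit : ∀ a → IsBit (qint -1ℤ a)
qint-isBit zero = inj₁ refl
qint-isBit (suc a) with qint-isBit a
... | inj₁ e rewrite e = inj₂ refl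
... | inj₂ e rewrite e = inj₁ refl

[_]₋₁≡1 : ℕ → Set
[ c ]₋₁≡1 = qint -1ℤ c ≡ + 1

module _ (T : Array) where

  rowProd-isBit : ∀ i j xs → IsBit (rowProd -1ℤ T i j xs)
  rowProd-isBit i j []       = inj₂ refl
  rowProd-isBit i j (x ∷ xs) = *-isBit (qint-isBit (cij T i j x)) (rowProd-isBit i (suc j) xs)

  cq'-isBit : ∀ i rs → IsBit (cq' -1ℤ T i rs)
  cq'-isBit i []              = inj₂ refl
  cq'-isBit i ([] ∷ rs)       = cq'-isBit (suc i) rs
  cq'-isBit i ((_ ∷ xs) ∷ rs) = *-isBit (rowProd-isBit i 0 xs) (cq'-isBit (suc i) rs)

  rowProd-≡1⁻ : ∀ i j xs → rowProd -1ℤ T i j xs ≡ + 1 →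
    ∀ a {x} → at xs a ≡ just x → [ cij T i (j + a) x ]₋₁≡1
  rowProd-≡1⁻ i j (y ∷ xs) e a ex with *-≡1⁻ (qint-isBit (cij T i j y)) (rowProd-isBit i (suc j) xs) e
  rowProd-≡1⁻ i j (y ∷ xs) e zero    refl | y≡1 , _ rewrite +-identityʳ j = y≡1
  rowProd-≡1⁻ i j (y ∷ xs) e (suc a) ex   | _ , xs≡1 rewrite +-suc j a =
    rowProd-≡1⁻ i (suc j) xs xs≡1 a ex

  rowProd-≡1⁺ : ∀ i j xs → (∀ a {x} → at xs a ≡ just x → [ cij T i (j + a) x ]₋₁≡1) →
    rowProd -1ℤ T i j xs ≡ + 1
  rowProd-≡1⁺ i j []       _ = refl
  rowProd-≡1⁺ i j (y ∷ xs) h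
    rewrite subst (λ k → [ cij T i k y ]₋₁≡1) (+-identityʳ j) (h 0 refl)
          | rowProd-≡1⁺ i (suc j) xs λ a {x} ex →
              subst (λ k → [ cij T i k x ]₋₁≡1) (+-suc j a) (h (suc a) ex)
    = refl

  cq'-≡1⁻ : ∀ i rs → cq' -1ℤ T i rs ≡ + 1 →
    ∀ k p {x} → entry rs k (suc p) ≡ just x → [ cij T (i + k) p x ]₋₁≡1
  cq'-≡1⁻ i ([] ∷ rs) e (suc k) p ex rewrite +-suc i k = cq'-≡1⁻ (suc i) rs e k p ex
  cq'-≡1⁻ i ((y ∷ xs) ∷ rs) e k p ex with *-≡1⁻ (rowProd-isBit i 0 xs) (cq'-isBit (suc i) rs) e
  cq'-≡1⁻ i ((y ∷ xs) ∷ rs) e zero    p ex | row≡1 , _ rewrite +-identityʳ i =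
    rowProd-≡1⁻ i 0 xs row≡1 p ex
  cq'-≡1⁻ i ((y ∷ xs) ∷ rs) e (suc k) p ex | _ , rest≡1 rewrite +-suc i k =
    cq'-≡1⁻ (suc i) rs rest≡1 k p ex

  cells-below-first-row : ∀ {i r rs} →
    (∀ k p {x} → entry (r ∷ rs) k (suc p) ≡ just x → [ cij T (i + k) p x ]₋₁≡1) →
    ∀ k p {x} → entry rs k (suc p) ≡ just x → [ cij T (suc i + k) p x ]₋₁≡1
  cells-below-first-row {i} h k p {x} ex = subst (λ m → [ cij T m p x ]₋₁≡1) (+-suc i k) (h (suc k) p ex)

  cq'-≡1⁺ : ∀ i rs → (∀ k p {x} → entry rs k (suc p) ≡ just x → [ cij T (i + k) p x ]₋₁≡1) →
    cq' -1ℤ T i rs ≡ + 1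
  cq'-≡1⁺ i []              _ = refl
  cq'-≡1⁺ i ([] ∷ rs)       h = cq'-≡1⁺ (suc i) rs (cells-below-first-row h)
  cq'-≡1⁺ i ((y ∷ xs) ∷ rs) h
    rewrite rowProd-≡1⁺ i 0 xs (λ p {x} ex → subst (λ k → [ cij T k p x ]₋₁≡1) (+-identityʳ i) (h 0 p ex))
          | cq'-≡1⁺ (suc i) rs (cells-below-first-row h)
    = refl

  cq-≡1⇔ : cq -1ℤ T ≡ + 1 ⇔ FactorsSatisfy [_]₋₁≡1 T
  cq-≡1⇔ = mk⇔ (cq'-≡1⁻ 0 T) (cq'-≡1⁺ 0 T)

bOver-−1 : ∀ L → bOver -1ℤ L ≡ + length (filter (λ T → cq -1ℤ T ℤ.≟ + 1) L)
bOver-−1 []      = refl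
bOver-−1 (T ∷ L) with cq -1ℤ T ℤ.≟ + 1 | cq'-isBit T 0 T
... | yes e | _      rewrite e | bOver-−1 L = refl
... | no ≢1 | inj₂ e = contradiction e ≢1
... | no _  | inj₁ e rewrite e | bOver-−1 L = ℤ.+-identityˡ _

module _ {ps : List ℕ} {T : Array} (λ-partition : IsPartition ps) (st : StandardTableau ps T) where

  open StandardTableau st using (shape; entries)

  standard⇒strict : IsStrictTableau T
  standard⇒strict = record
    { decreasing = map⁻ (subst (Linked _≥_) (sym shape) (proj₂ λ-partition))
    ; rows       = StandardTableau.rows st
    ; cols       = StandardTableau.cols st
    }

  standard-unique : Unique (concat T)
  standard-unique =
    ↭ₛ.Unique-resp-↭ (setoid ℕ) (↭⇒↭ₛ (↭-sym entries)) (Unique.map⁺ suc-injective (upTo⁺ _))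

  cq≡1⇔shiftedColumnStrict : AlmostStrict ps → cq -1ℤ T ≡ + 1 ⇔ ShiftedColumnStrict T
  cq≡1⇔shiftedColumnStrict almostStrict = mk⇔
    (λ cq≡1 → factors≢2⇒shiftedColumnStrict standard⇒strict standard-unique leading
                λ i p ex c≡2 → [2]₋₁≢1 (subst [_]₋₁≡1 c≡2 (Equivalence.to (cq-≡1⇔ T) cq≡1 i p ex)))
    (λ sh → Equivalence.from (cq-≡1⇔ T)
                λ i p ex → cong (qint -1ℤ) (shiftedColumnStrict⇒cij≡1 standard⇒strict sh i p ex))
    where
    leading : RepeatsAreLeading (map length T)
    leading = subst RepeatsAreLeading (sym shape)
                (almostStrict⇒repeatsAreLeading (proj₂ λ-partition) almostStrict)
    [2]₋₁≢1 : ¬ [ 2 ]₋₁≡1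
    [2]₋₁≢1 ()

standard∧cq≡1⇔shifted : ∀ {ps T} → IsPartition ps → AlmostStrict ps →
  (StandardTableau ps T × cq -1ℤ T ≡ + 1) ⇔ StandardShiftedTableau ps T
standard∧cq≡1⇔shifted λ-partition almostStrict = mk⇔
  (λ (st , cq≡1) →
     standard⇒shifted (st , Equivalence.to (cq≡1⇔shiftedColumnStrict λ-partition st almostStrict) cq≡1))
  (λ sst → let st , sh = shifted⇒standard sst
           in st , Equivalence.from (cq≡1⇔shiftedColumnStrict λ-partition st almostStrict) sh)

unique-sameMembers⇒length≡ : ∀ {A : Set} {xs ys : List A} → Unique xs → Unique ys →
  (∀ {z} → z ∈ xs ⇔ z ∈ ys) → length xs ≡ length ys
unique-sameMembers⇒length≡ ux uy xs≈ys = ↭-length (∼bag⇒↭ (unique∧set⇒bag ux uy xs≈ys))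

theorem3p18 : (ps : List ℕ) → IsPartition ps → AlmostStrict ps →
    (L S : List (List (List ℕ))) →
    IsEnumerationOf (StandardTableau ps) L →
    IsEnumerationOf (StandardShiftedTableau ps) S →
    bOver -[1+ 0 ] L ≡ + length S
theorem3p18 ps λ-partition almostStrict L S (uniqueL , ∈L⇔) (uniqueS , ∈S⇔) = begin
  bOver -1ℤ L               ≡⟨ bOver-−1 L ⟩
  + length (filter cq≡1? L) ≡⟨ cong +_ (unique-sameMembers⇒length≡ (Unique.filter⁺ cq≡1? uniqueL) uniqueS members) ⟩
  + length S                ∎
  where
  open ≡-Reasoning
  cq≡1? = λ T → cq -1ℤ T ℤ.≟ + 1
  shifted⇔ : ∀ {T} → (StandardTableau ps T × cq -1ℤ T ≡ + 1) ⇔ StandardShiftedTableau ps T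
  shifted⇔ = standard∧cq≡1⇔shifted λ-partition almostStrict
  members : ∀ {T} → T ∈ filter cq≡1? L ⇔ T ∈ S
  members {T} = mk⇔
    (λ T∈ → let T∈L , cq≡1 = ∈-filter⁻ cq≡1? T∈
            in Equivalence.from (∈S⇔ T) (Equivalence.to shifted⇔ (Equivalence.to (∈L⇔ T) T∈L , cq≡1)))
    (λ T∈S → let st , cq≡1 = Equivalence.from shifted⇔ (Equivalence.to (∈S⇔ T) T∈S)
             in ∈-filter⁺ cq≡1? (Equivalence.from (∈L⇔ T) st) cq≡1)
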